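{- The theory $\mathsf{PA}^-_{\mathsf{jer}}$ plus the GCD Principle $\forall x\,\forall y\,\exists z\,\forall u\,(u\mid z\leftrightarrow(u\mid x\wedge u\mid y))$ proves the Primality Principle: $x\mid y\cdot z\to\exists u\,\exists v\,(x=u\cdot v\wedge u\mid y\wedge v\mid z)$.
   Context: $\mathsf{PA}^-_{\mathsf{jer}}$ is the theory in the language $0,1,+,\times,\leq$ with axioms: $x+0=x$; $x+y=y+x$; $(x+y)+z=x+(y+z)$; $x\cdot1=x$; $x\cdot y=y\cdot x$; $(x\cdot y)\cdot z=x\cdot(y\cdot z)$; $x\cdot(y+z)=x\cdot y+x\cdot z$; $x\leq y\vee y\leq x$; $(x\leq y\wedge y\leq z)\to x\leq z$; $x+1\not\leq x$; $y\leq x\to(y=x\vee y+1\leq x)$; $y\leq x\to y+z\leq x+z$; $y\leq x\to y\cdot z\leq x\cdot z$. $x\mid y$ means $\exists z\,z\cdot x=y$. -}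

module Defs where

open import Data.Product using (Σ; ∃; _×_; _,_)
open import Data.Sum using (_⊎_)
open import Relation.Binary.PropositionalEquality using (_≡_)
open import Relation.Nullary using (¬_)

record PAjerModel : Set₁ where
  infixl 6 _+_
  infixl 7 _·_
  infix 4 _≤_
  field
    M   : Set
    𝟘 𝟙 : M
    _+_ _·_ : M → M → M
    _≤_ : M → M → Set
    +-zero  : ∀ x → x + 𝟘 ≡ x
    +-comm  : ∀ x y → x + y ≡ y + x
    +-assoc : ∀ x y z → (x + y) + z ≡ x + (y + z)
    ·-one   : ∀ x → x · 𝟙 ≡ x
    ·-comm  : ∀ x y → x · y ≡ y · x
    ·-assoc : ∀ x y z → (x · y) · z ≡ x · (y · z)
    distrib : ∀ x y z → x · (y + z) ≡ x · y + x · z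
    ≤-total : ∀ x y → x ≤ y ⊎ y ≤ x
    ≤-trans : ∀ x y z → x ≤ y → y ≤ z → x ≤ z
    succ-not-≤ : ∀ x → ¬ (x + 𝟙 ≤ x)
    ≤-discrete : ∀ x y → y ≤ x → (y ≡ x ⊎ y + 𝟙 ≤ x)
    ≤-+ : ∀ x y z → y ≤ x → y + z ≤ x + z
    ≤-· : ∀ x y z → y ≤ x → y · z ≤ x · z

  infix 4 _∣_
  _∣_ : M → M → Set
  x ∣ y = ∃ λ z → z · x ≡ y


GCDPrinciple : PAjerModel → Set
GCDPrinciple 𝕄 = ∀ x y → ∃ λ z → ∀ u →
  ((u ∣ z) → (u ∣ x) × (u ∣ y)) × ((u ∣ x) × (u ∣ y) → (u ∣ z))
  where open PAjerModel 𝕄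

PrimalityPrinciple : PAjerModel → Set
PrimalityPrinciple 𝕄 = ∀ x y z → x ∣ (y · z) →
  ∃ λ u → ∃ λ v → (x ≡ u · v) × (u ∣ y) × (v ∣ z)
  where open PAjerModel 𝕄

{-# OPTIONS --safe #-}
module Submission where

open import Defs
open import Data.Product using (∃; _×_; _,_; proj₁; proj₂)
open import Data.Sum using (_⊎_; inj₁; inj₂)
open import Data.Empty using (⊥-elim)
open import Relation.Nullary using (¬_)
open import Relation.Binary.PropositionalEquality

-- The cases y = 0 and z = 0 are trivial. Otherwise let d be a gcd of x and y,
-- and g one of x·z and y·z. Then z ∣ g, say g = w·z, and cancelling z in
-- w·z ∣ x·z and w·z ∣ y·z makes w a common divisor of x and y, so g ∣ d·z.
-- As x divides both x·z and y·z, x = a·d ∣ g ∣ d·z, and cancelling d gives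
-- a ∣ z; hence x = d·a with d ∣ y and a ∣ z. Both cancellations hold because
-- in a discrete linear order strictly monotone maps are injective.

module PAjerArithmetic (𝕄 : PAjerModel) where
  open PAjerModel 𝕄
  open ≡-Reasoning

  private
    variable
      a b d g x y z : M

  infix 4 _<_
  _<_ : M → M → Set
  x < y = x + 𝟙 ≤ y

  <-irrefl : ¬ x < x
  <-irrefl {x} = succ-not-≤ x

  StrictlyMonotone : (M → M) → Set
  StrictlyMonotone f = ∀ {a b} → a < b → f a < f b

  strictMono-≤⇒injective : ∀ f → StrictlyMonotone f → x ≤ y → f x ≡ f y → x ≡ y
  strictMono-≤⇒injective {x} {y} f mono x≤y fx≡fy with ≤-discrete y x x≤y
  ... | inj₁ x≡y = x≡y
  ... | inj₂ x<y = ⊥-elim (<-irrefl (subst (f x <_) (sym fx≡fy) (mono x<y)))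

  strictMono⇒injective : ∀ f → StrictlyMonotone f → f x ≡ f y → x ≡ y
  strictMono⇒injective {x} {y} f mono fx≡fy with ≤-total x y
  ... | inj₁ x≤y = strictMono-≤⇒injective f mono x≤y fx≡fy
  ... | inj₂ y≤x = sym (strictMono-≤⇒injective f mono y≤x (sym fx≡fy))

  +-identityˡ : ∀ x → 𝟘 + x ≡ x
  +-identityˡ x = trans (+-comm 𝟘 x) (+-zero x)

  ·-identityˡ : ∀ x → 𝟙 · x ≡ x
  ·-identityˡ x = trans (·-comm 𝟙 x) (·-one x)

  +-monoˡ-< : ∀ z → a < b → a + z < b + z
  +-monoˡ-< {a} {b} z a<b = subst (_≤ b + z) shift (≤-+ b (a + 𝟙) z a<b)
    where
    shift : a + 𝟙 + z ≡ a + z + 𝟙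
    shift = begin
      a + 𝟙 + z   ≡⟨ +-assoc a 𝟙 z ⟩
      a + (𝟙 + z) ≡⟨ cong (a +_) (+-comm 𝟙 z) ⟩
      a + (z + 𝟙) ≡⟨ +-assoc a z 𝟙 ⟨
      a + z + 𝟙   ∎

  +-cancelʳ : ∀ z → x + z ≡ y + z → x ≡ y
  +-cancelʳ z = strictMono⇒injective (_+ z) (+-monoˡ-< z)

  ·-zeroʳ : ∀ x → x · 𝟘 ≡ 𝟘
  ·-zeroʳ x = +-cancelʳ (x · 𝟘) (begin
    x · 𝟘 + x · 𝟘 ≡⟨ distrib x 𝟘 𝟘 ⟨
    x · (𝟘 + 𝟘)   ≡⟨ cong (x ·_) (+-zero 𝟘) ⟩
    x · 𝟘         ≡⟨ +-identityˡ (x · 𝟘) ⟨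
    𝟘 + x · 𝟘     ∎)

  ·-zeroˡ : ∀ x → 𝟘 · x ≡ 𝟘
  ·-zeroˡ x = trans (·-comm 𝟘 x) (·-zeroʳ x)

  𝟘≤𝟙 : 𝟘 ≤ 𝟙
  𝟘≤𝟙 with ≤-total 𝟘 𝟙
  ... | inj₁ 𝟘≤𝟙 = 𝟘≤𝟙
  ... | inj₂ 𝟙≤𝟘 = ⊥-elim (<-irrefl (subst₂ _≤_ (·-identityˡ (𝟘 + 𝟙)) (·-zeroˡ (𝟘 + 𝟙))
                                              (≤-· 𝟘 𝟙 (𝟘 + 𝟙) 𝟙≤𝟘)))

  𝟘-minimum : ∀ x → 𝟘 ≤ x
  𝟘-minimum x = subst₂ _≤_ (·-zeroˡ x) (·-identityˡ x) (≤-· 𝟙 𝟘 x 𝟘≤𝟙)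

  zero-or-positive : ∀ x → x ≡ 𝟘 ⊎ 𝟘 < x
  zero-or-positive x with ≤-discrete x 𝟘 (𝟘-minimum x)
  ... | inj₁ 𝟘≡x = inj₁ (sym 𝟘≡x)
  ... | inj₂ 𝟘<x = inj₂ 𝟘<x

  ·-monoˡ-< : 𝟘 < z → a < b → a · z < b · z
  ·-monoˡ-< {z} {a} {b} 𝟘<z a<b = ≤-trans _ _ _ a·z<a·z+z a·z+z≤b·z
    where
    a·z<a·z+z : a · z < a · z + z
    a·z<a·z+z = subst₂ _≤_ (trans (+-comm (𝟘 + 𝟙) (a · z)) (cong (a · z +_) (+-identityˡ 𝟙)))
                           (+-comm z (a · z))
                           (≤-+ z (𝟘 + 𝟙) (a · z) 𝟘<z)
    a·z+z≤b·z : a · z + z ≤ b · z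
    a·z+z≤b·z = subst (_≤ b · z) (begin
      (a + 𝟙) · z     ≡⟨ ·-comm (a + 𝟙) z ⟩
      z · (a + 𝟙)     ≡⟨ distrib z a 𝟙 ⟩
      z · a + z · 𝟙   ≡⟨ cong₂ _+_ (·-comm z a) (·-one z) ⟩
      a · z + z       ∎) (≤-· b (a + 𝟙) z a<b)

  ·-cancelʳ : 𝟘 < z → x · z ≡ y · z → x ≡ y
  ·-cancelʳ {z} 𝟘<z = strictMono⇒injective (_· z) (·-monoˡ-< 𝟘<z)

  ∣-refl : x ∣ x
  ∣-refl {x} = 𝟙 , ·-identityˡ x

  ∣-trans : x ∣ y → y ∣ z → x ∣ z
  ∣-trans {x} (p , p·x≡y) (q , q·y≡z) =
    q · p , trans (·-assoc q p x) (trans (cong (q ·_) p·x≡y) q·y≡z)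

  𝟙∣ : ∀ x → 𝟙 ∣ x
  𝟙∣ x = x , ·-one x

  ∣𝟘 : ∀ x → x ∣ 𝟘
  ∣𝟘 x = 𝟘 , ·-zeroˡ x

  x∣x·y : ∀ x y → x ∣ x · y
  x∣x·y x y = y , ·-comm y x

  y∣x·y : ∀ x y → y ∣ x · y
  y∣x·y x y = x , refl

  ·-monoˡ-∣ : ∀ z → x ∣ y → x · z ∣ y · z
  ·-monoˡ-∣ {x} z (q , q·x≡y) = q , trans (sym (·-assoc q x z)) (cong (_· z) q·x≡y)

  ·-cancelʳ-∣ : 𝟘 < z → x · z ∣ y · z → x ∣ y
  ·-cancelʳ-∣ {z} {x} 𝟘<z (q , q·xz≡yz) = q , ·-cancelʳ 𝟘<z (trans (·-assoc q x z) q·xz≡yz)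

  ∣-positive : 𝟘 < y → x ∣ y → 𝟘 < x
  ∣-positive {y} {x} 𝟘<y (q , q·x≡y) with zero-or-positive x
  ... | inj₂ 𝟘<x = 𝟘<x
  ... | inj₁ x≡𝟘 = ⊥-elim (<-irrefl (subst (𝟘 <_) y≡𝟘 𝟘<y))
    where
    y≡𝟘 : y ≡ 𝟘
    y≡𝟘 = trans (sym q·x≡y) (trans (cong (q ·_) x≡𝟘) (·-zeroʳ q))

  IsGCD : M → M → M → Set
  IsGCD d x y = ∀ u → (u ∣ d → (u ∣ x) × (u ∣ y)) × ((u ∣ x) × (u ∣ y) → u ∣ d)

  gcd-∣ˡ : IsGCD d x y → d ∣ x
  gcd-∣ˡ {d} gcd = proj₁ (proj₁ (gcd d) ∣-refl)

  gcd-∣ʳ : IsGCD d x y → d ∣ y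
  gcd-∣ʳ {d} gcd = proj₂ (proj₁ (gcd d) ∣-refl)

  gcd-greatest : IsGCD d x y → ∀ {u} → u ∣ x → u ∣ y → u ∣ d
  gcd-greatest gcd {u} u∣x u∣y = proj₂ (gcd u) (u∣x , u∣y)

  gcd-·ʳ-∣ : 𝟘 < z → IsGCD d x y → IsGCD g (x · z) (y · z) → g ∣ d · z
  gcd-·ʳ-∣ {z} {x = x} {y} 𝟘<z gcd gcd·z with gcd-greatest gcd·z (y∣x·y x z) (y∣x·y y z)
  ... | w , refl = ·-monoˡ-∣ z (gcd-greatest gcd (cancel (gcd-∣ˡ gcd·z)) (cancel (gcd-∣ʳ gcd·z)))
    where
    cancel : ∀ {v} → w · z ∣ v · z → w ∣ v
    cancel = ·-cancelʳ-∣ 𝟘<z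

  Splitting : M → M → M → Set
  Splitting x y z = ∃ λ u → ∃ λ v → (x ≡ u · v) × (u ∣ y) × (v ∣ z)

  splitting-zeroˡ : y ≡ 𝟘 → Splitting x y z
  splitting-zeroˡ {y} {x} {z} y≡𝟘 = x , 𝟙 , sym (·-one x) , subst (x ∣_) (sym y≡𝟘) (∣𝟘 x) , 𝟙∣ z

  splitting-zeroʳ : z ≡ 𝟘 → Splitting x y z
  splitting-zeroʳ {z} {x} {y} z≡𝟘 = 𝟙 , x , sym (·-identityˡ x) , 𝟙∣ y , subst (x ∣_) (sym z≡𝟘) (∣𝟘 x)

  splitting-from-gcds : 𝟘 < y → 𝟘 < z → IsGCD d x y → IsGCD g (x · z) (y · z) →
                        x ∣ y · z → Splitting x y z
  splitting-from-gcds {y} {z} {d} 𝟘<y 𝟘<z gcd gcd·z x∣y·z with gcd-∣ˡ gcd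
  ... | a , refl = d , a , ·-comm a d , gcd-∣ʳ gcd , ·-cancelʳ-∣ 𝟘<d a·d∣z·d
    where
    𝟘<d : 𝟘 < d
    𝟘<d = ∣-positive 𝟘<y (gcd-∣ʳ gcd)
    a·d∣z·d : a · d ∣ z · d
    a·d∣z·d = subst (a · d ∣_) (·-comm d z)
                (∣-trans (gcd-greatest gcd·z (x∣x·y (a · d) z) x∣y·z) (gcd-·ʳ-∣ 𝟘<z gcd gcd·z))

mainTheorem11 : (𝕄 : PAjerModel) → GCDPrinciple 𝕄 → PrimalityPrinciple 𝕄
mainTheorem11 𝕄 gcd x y z x∣y·z = split (zero-or-positive y) (zero-or-positive z)
  where
  open PAjerModel 𝕄
  open PAjerArithmetic 𝕄
  split : y ≡ 𝟘 ⊎ 𝟘 < y → z ≡ 𝟘 ⊎ 𝟘 < z → Splitting x y z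
  split (inj₁ y≡𝟘) _ = splitting-zeroˡ y≡𝟘
  split _ (inj₁ z≡𝟘) = splitting-zeroʳ z≡𝟘
  split (inj₂ 𝟘<y) (inj₂ 𝟘<z) =
    splitting-from-gcds 𝟘<y 𝟘<z (proj₂ (gcd x y)) (proj₂ (gcd (x · z) (y · z))) x∣y·z
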